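{- Let $X=(V,E)$ be a finite undirected graph with a vertex $e$ adjacent to every other vertex of $X$. Suppose $V\setminus\{e\}$ can be partitioned into sets $C_1,\dots,C_m$ such that each induced subgraph $X[C_i]$ is a complete graph with at least two vertices. Then the oriented diameter of $X$ is at most $4$.
   Context: An orientation of an undirected graph $X$ assigns exactly one direction to each edge of $X$. For a directed graph $D$, $d_D(u,v)$ is the length of a shortest directed path from $u$ to $v$ ($\infty$ if none exists), and $diam(D)=\max_{u,v} d_D(u,v)$. The oriented diameter $OD(X)$ of $X$ is the minimum of $diam(D)$ over all directed graphs $D$ obtained from $X$ by an orientation. -}

module Defs where

open import Data.Nat using (ℕ; zero; suc; _≤_)
open import Data.Fin using (Fin)
open import Data.Product using (Σ; _×_; ∃; ∃-syntax)
open import Data.Sum using (_⊎_)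
open import Relation.Nullary using (¬_)
open import Relation.Binary.PropositionalEquality using (_≡_; _≢_)

record Graph (n : ℕ) : Set₁ where
  field
    Adj     : Fin n → Fin n → Set
    sym     : ∀ {u v} → Adj u v → Adj v u
    irrefl  : ∀ {u} → ¬ Adj u u
open Graph public

record Orientation {n : ℕ} (X : Graph n) : Set₁ where
  field
    Arc      : Fin n → Fin n → Set
    arc-edge : ∀ {u v} → Arc u v → Adj X u v
    edge-arc : ∀ {u v} → Adj X u v → Arc u v ⊎ Arc v u
    one-dir  : ∀ {u v} → ¬ (Arc u v × Arc v u)
open Orientation public

data Walk {n : ℕ} (A : Fin n → Fin n → Set) : Fin n → Fin n → ℕ → Set where
  [] : ∀ {u} → Walk A u u zero
  _∷_ : ∀ {u w v k} → A u w → Walk A w v k → Walk A u v (suc k)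

DistLE : {n : ℕ} → (Fin n → Fin n → Set) → Fin n → Fin n → ℕ → Set
DistLE A u v k = ∃[ l ] (l ≤ k × Walk A u v l)

DiamLE : {n : ℕ} → (Fin n → Fin n → Set) → ℕ → Set
DiamLE {n} A k = ∀ (u v : Fin n) → DistLE A u v k

OrientedDiamLE : {n : ℕ} → Graph n → ℕ → Set₁
OrientedDiamLE X k = ∃[ D ] DiamLE (Arc {X = X} D) k

Universal : {n : ℕ} → Graph n → Fin n → Set
Universal {n} X e = ∀ (v : Fin n) → v ≢ e → Adj X e v

-- V \ {e} partitioned into C_1..C_m (given by a class map on V \ {e}),
-- each class of size ≥ 2 and inducing a complete graph.
record CliquePartition {n : ℕ} (X : Graph n) (e : Fin n) (m : ℕ) : Set where
  field
    cls      : (v : Fin n) → v ≢ e → Fin m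
    big      : ∀ (i : Fin m) → ∃[ u ] ∃[ v ] Σ (u ≢ e) λ ue → Σ (v ≢ e) λ ve →
                 u ≢ v × cls u ue ≡ i × cls v ve ≡ i
    complete : ∀ (u v : Fin n) (ue : u ≢ e) (ve : v ≢ e) →
                 u ≢ v → cls u ue ≡ cls v ve → Adj X u v

{-# OPTIONS --safe #-}
-- Colour V ∖ {e} with two colours so that every vertex has a neighbour of the other
-- colour: as X − e has no isolated vertex, a maximal independent set of (a spanning
-- subgraph of) X − e and its complement will do. Orient e → first colour → second
-- colour → e, and the edges inside a colour class arbitrarily. Every vertex then
-- reaches e, and is reached from e, in at most two steps.
module Submission where

open import Defs
open import Data.Bool using (Bool; true; false; not)
import Data.Bool as Bool
open import Data.Bool.Properties using (¬-not)
open import Data.Empty using (⊥-elim)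
open import Data.Fin using (Fin; zero; suc; _<_; _≟_)
open import Data.Fin.Properties using (<-cmp; any?)
open import Data.Nat using (ℕ; zero; suc; _+_; z≤n; s≤s)
open import Data.Nat.Properties using (≤-refl; +-mono-≤)
open import Data.Product using (_×_; _,_; proj₁; proj₂; ∃-syntax)
open import Data.Product.Relation.Binary.Lex.Strict using (×-Lex; ×-compare)
open import Data.Product.Relation.Binary.Pointwise.NonDependent using (Pointwise)
open import Data.Sum using (_⊎_; inj₁; inj₂; swap)
open import Function using (_on_)
open import Level using (Level; 0ℓ)
open import Relation.Binary.Core using (Rel; _⇒_)
open import Relation.Binary.Definitions using (Symmetric; Decidable; Trichotomous; tri<; tri≈; tri>)
open import Relation.Binary.Consequences using (tri⇒asym)
import Relation.Binary.Construct.On as On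
open import Relation.Binary.PropositionalEquality using (_≡_; _≢_; refl; subst)
import Relation.Binary.PropositionalEquality as ≡
open import Relation.Nullary using (¬_; yes; no)
open import Relation.Nullary.Decidable using (_×-dec_; _⊎-dec_; ¬?)

open CliquePartition using (cls; big; complete)

private
  variable
    n : ℕ
    ℓ : Level

_++ᵂ_ : {A : Rel (Fin n) 0ℓ} {u w v : Fin n} {k l : ℕ} →
        Walk A u w k → Walk A w v l → Walk A u v (k + l)
[] ++ᵂ q = q
(a ∷ p) ++ᵂ q = a ∷ (p ++ᵂ q)

distLE-trans : {A : Rel (Fin n) 0ℓ} {u w v : Fin n} {k l : ℕ} →
               DistLE A u w k → DistLE A w v l → DistLE A u v (k + l)
distLE-trans (_ , i≤k , p) (_ , j≤l , q) = _ , +-mono-≤ i≤k j≤l , p ++ᵂ q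

orientAlong : (X : Graph n) {_≈_ : Rel (Fin n) ℓ} {_≺_ : Rel (Fin n) 0ℓ} →
              _≈_ ⇒ _≡_ → Trichotomous _≈_ _≺_ → Orientation X
orientAlong {n} X {_≺_ = _≺_} ≈⇒≡ cmp = record
  { Arc      = λ u v → Adj X u v × u ≺ v
  ; arc-edge = λ (adj , _) → adj
  ; edge-arc = orient-edge
  ; one-dir  = λ ((_ , u≺v) , (_ , v≺u)) → tri⇒asym cmp u≺v v≺u
  }
  where
  orient-edge : {u v : Fin n} → Adj X u v → (Adj X u v × u ≺ v) ⊎ (Adj X v u × v ≺ u)
  orient-edge {u} {v} adj with cmp u v
  ... | tri< u≺v _ _ = inj₁ (adj , u≺v)
  ... | tri≈ _ u≈v _ = ⊥-elim (irrefl X (subst (Adj X u) (≡.sym (≈⇒≡ u≈v)) adj))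
  ... | tri> _ _ v≺u = inj₂ (sym X adj , v≺u)

data Kind : Set where
  hub source sink : Kind

data _⇾_ : Rel Kind 0ℓ where
  hub⇾source  : hub ⇾ source
  source⇾sink : source ⇾ sink
  sink⇾hub    : sink ⇾ hub

⇾-cmp : Trichotomous _≡_ _⇾_
⇾-cmp hub    hub    = tri≈ (λ ()) refl (λ ())
⇾-cmp hub    source = tri< hub⇾source (λ ()) (λ ())
⇾-cmp hub    sink   = tri> (λ ()) (λ ()) sink⇾hub
⇾-cmp source hub    = tri> (λ ()) (λ ()) hub⇾source
⇾-cmp source source = tri≈ (λ ()) refl (λ ())
⇾-cmp source sink   = tri< source⇾sink (λ ()) (λ ())
⇾-cmp sink   hub    = tri< sink⇾hub (λ ()) (λ ())
⇾-cmp sink   source = tri> (λ ()) (λ ()) source⇾sink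
⇾-cmp sink   sink   = tri≈ (λ ()) refl (λ ())

pole : Bool → Kind
pole true  = source
pole false = sink

OppositeNeighbours : Graph n → Fin n → (Fin n → Bool) → Set
OppositeNeighbours X e c = ∀ v → v ≢ e → ∃[ w ] (w ≢ e × Adj X v w × c w ≡ not (c v))

module HubOrientation (X : Graph n) (e : Fin n) (c : Fin n → Bool) where

  kind : Fin n → Kind
  kind v with v ≟ e
  ... | yes _ = hub
  ... | no _  = pole (c v)

  kind-hub : kind e ≡ hub
  kind-hub with e ≟ e
  ... | yes _   = refl
  ... | no e≢e = ⊥-elim (e≢e refl)

  kind-pole : {v : Fin n} {b : Bool} → v ≢ e → c v ≡ b → kind v ≡ pole b
  kind-pole {v} v≢e refl with v ≟ e
  ... | yes v≡e = ⊥-elim (v≢e v≡e)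
  ... | no _    = refl

  rank : Fin n → Kind × Fin n
  rank v = kind v , v

  _≺_ : Rel (Fin n) 0ℓ
  _≺_ = ×-Lex _≡_ _⇾_ _<_ on rank

  ≺-cmp : Trichotomous (Pointwise _≡_ _≡_ on rank) _≺_
  ≺-cmp = On.trichotomous rank _ _ (×-compare ≡.sym ⇾-cmp <-cmp)

  orientation : Orientation X
  orientation = orientAlong X proj₂ ≺-cmp

  step : {u v : Fin n} {k l : Kind} → Adj X u v → kind u ≡ k → kind v ≡ l → k ⇾ l →
         Arc orientation u v
  step adj refl refl k⇾l = adj , inj₁ k⇾l

  module _ (universal : Universal X e) (opposite : OppositeNeighbours X e c) where

    hub→source : {v : Fin n} → v ≢ e → c v ≡ true → Arc orientation e v
    hub→source v≢e cv = step (universal _ v≢e) kind-hub (kind-pole v≢e cv) hub⇾source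

    source→sink : {u v : Fin n} → Adj X u v → u ≢ e → v ≢ e → c u ≡ true → c v ≡ false →
                  Arc orientation u v
    source→sink adj u≢e v≢e cu cv = step adj (kind-pole u≢e cu) (kind-pole v≢e cv) source⇾sink

    sink→hub : {v : Fin n} → v ≢ e → c v ≡ false → Arc orientation v e
    sink→hub v≢e cv = step (sym X (universal _ v≢e)) (kind-pole v≢e cv) kind-hub sink⇾hub

    toHub : ∀ u → DistLE (Arc orientation) u e 2
    toHub u with u ≟ e
    ... | yes refl = 0 , z≤n , []
    ... | no u≢e with c u in cu | opposite u u≢e
    ...   | false | _                  = 1 , s≤s z≤n , sink→hub u≢e cu ∷ []
    ...   | true  | w , w≢e , adj , cw =
      2 , ≤-refl , source→sink adj u≢e w≢e cu cw ∷ (sink→hub w≢e cw ∷ [])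

    fromHub : ∀ v → DistLE (Arc orientation) e v 2
    fromHub v with v ≟ e
    ... | yes refl = 0 , z≤n , []
    ... | no v≢e with c v in cv | opposite v v≢e
    ...   | true  | _                  = 1 , s≤s z≤n , hub→source v≢e cv ∷ []
    ...   | false | w , w≢e , adj , cw =
      2 , ≤-refl , hub→source w≢e cw ∷ (source→sink (sym X adj) w≢e v≢e cw cv ∷ [])

    orientedDiam≤4 : OrientedDiamLE X 4
    orientedDiam≤4 = orientation , λ u v → distLE-trans (toHub u) (fromHub v)

record IsMaximalIndependent (H : Rel (Fin n) ℓ) (I : Fin n → Bool) : Set ℓ where
  field
    independent : {u v : Fin n} → I u ≡ true → I v ≡ true → H u v → u ≡ v
    maximal     : {v : Fin n} → I v ≡ false → ∃[ u ] (I u ≡ true × H u v)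

greedyIndependent : {H : Rel (Fin n) ℓ} → Decidable H → Fin n → Bool
greedyIndependent {suc n} {H = H} H? zero
  with any? (λ j → (greedyIndependent (On.decidable suc H H?) j Bool.≟ true) ×-dec H? zero (suc j))
... | yes _ = false
... | no _  = true
greedyIndependent {suc n} {H = H} H? (suc i) = greedyIndependent (On.decidable suc H H?) i

greedy-isMaximalIndependent : {H : Rel (Fin n) ℓ} → Symmetric H → (H? : Decidable H) →
                              IsMaximalIndependent H (greedyIndependent H?)
greedy-isMaximalIndependent {zero} _ _ =
  record { independent = λ { {()} } ; maximal = λ { {()} } }
greedy-isMaximalIndependent {suc n} {H = H} H-sym H? =
  record { independent = independent ; maximal = maximal }
  where
  I : Fin (suc n) → Bool
  I = greedyIndependent H?

  I⁺ : Fin n → Bool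
  I⁺ = greedyIndependent (On.decidable suc H H?)
  module IH = IsMaximalIndependent (greedy-isMaximalIndependent H-sym (On.decidable suc H H?))

  zero-in : I zero ≡ true → ¬ (∃[ j ] (I⁺ j ≡ true × H zero (suc j)))
  zero-in with any? (λ j → (I⁺ j Bool.≟ true) ×-dec H? zero (suc j))
  ... | no ∄ = λ _ → ∄

  zero-out : I zero ≡ false → ∃[ j ] (I⁺ j ≡ true × H zero (suc j))
  zero-out with any? (λ j → (I⁺ j Bool.≟ true) ×-dec H? zero (suc j))
  ... | yes ∃ = λ _ → ∃

  independent : {u v : Fin (suc n)} → I u ≡ true → I v ≡ true → H u v → u ≡ v
  independent {zero}  {zero}  _   _   _ = refl
  independent {zero}  {suc j} I₀ Iⱼ h = ⊥-elim (zero-in I₀ (j , Iⱼ , h))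
  independent {suc i} {zero}  Iᵢ I₀ h = ⊥-elim (zero-in I₀ (i , Iᵢ , H-sym h))
  independent {suc i} {suc j} Iᵢ Iⱼ h = ≡.cong suc (IH.independent Iᵢ Iⱼ h)

  maximal : {v : Fin (suc n)} → I v ≡ false → ∃[ u ] (I u ≡ true × H u v)
  maximal {zero} I₀ with zero-out I₀
  ... | j , Iⱼ , h = suc j , Iⱼ , H-sym h
  maximal {suc i} Iᵢ with IH.maximal Iᵢ
  ... | j , Iⱼ , h = suc j , Iⱼ , h

NoIsolatedVertexBesides : Graph n → Fin n → Set
NoIsolatedVertexBesides X e = ∀ v → v ≢ e → ∃[ w ] (w ≢ e × Adj X v w)

module _ (X : Graph n) (e : Fin n) (noIsolated : NoIsolatedVertexBesides X e) where

  private
    neighbour : Fin n → Fin n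
    neighbour v with v ≟ e
    ... | yes _  = v
    ... | no v≢e = proj₁ (noIsolated v v≢e)

    neighbour-spec : {v : Fin n} → v ≢ e → neighbour v ≢ e × Adj X v (neighbour v)
    neighbour-spec {v} v≢e with v ≟ e
    ... | yes v≡e = ⊥-elim (v≢e v≡e)
    ... | no v≢e′ = proj₂ (noIsolated v v≢e′)

    -- Adj X need not be decidable, so the independent set is taken in the subgraph
    -- of the edges v — neighbour v (whose value at e is junk, hence the v ≢ e guards).
    Linked : Rel (Fin n) 0ℓ
    Linked u v = (u ≢ e × v ≡ neighbour u) ⊎ (v ≢ e × u ≡ neighbour v)

    linked? : Decidable Linked
    linked? u v = (¬? (u ≟ e) ×-dec v ≟ neighbour u)
             ⊎-dec (¬? (v ≟ e) ×-dec u ≟ neighbour v)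

    linked⇒adj : {u v : Fin n} → Linked u v → u ≢ e × Adj X u v
    linked⇒adj (inj₁ (u≢e , refl)) = u≢e , proj₂ (neighbour-spec u≢e)
    linked⇒adj (inj₂ (v≢e , refl)) =
      proj₁ (neighbour-spec v≢e) , sym X (proj₂ (neighbour-spec v≢e))

  oppositeColouring : ∃[ c ] OppositeNeighbours X e c
  oppositeColouring = c , opposite
    where
    c : Fin n → Bool
    c = greedyIndependent linked?

    open IsMaximalIndependent (greedy-isMaximalIndependent swap linked?)

    opposite : OppositeNeighbours X e c
    opposite v v≢e with c v in cv
    ... | true =
      let w≢e , adj = neighbour-spec v≢e
          v≢w = λ v≡w → irrefl X (subst (Adj X v) (≡.sym v≡w) adj)
      in neighbour v , w≢e , adj , ¬-not (λ cw → v≢w (independent cv cw (inj₁ (v≢e , refl))))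
    ... | false with maximal cv
    ...   | u , cu , linked = let u≢e , adj = linked⇒adj linked in u , u≢e , sym X adj , cu

-- The class of v may depend on the proof of v ≢ e, so the classes need not be
-- canonical; this is why only the absence of isolated vertices is extracted.
cliquePartition⇒noIsolated : {X : Graph n} {e : Fin n} {m : ℕ} →
                             CliquePartition X e m → NoIsolatedVertexBesides X e
cliquePartition⇒noIsolated P v v≢e with big P (cls P v v≢e)
... | a , b , a≢e , b≢e , a≢b , cls-a , cls-b with v ≟ a
...   | yes refl = b , b≢e , complete P v b v≢e b≢e a≢b (≡.sym cls-b)
...   | no v≢a   = a , a≢e , complete P v a v≢e a≢e v≢a (≡.sym cls-a)

mainTheorem6 : (n : ℕ) (X : Graph n) (e : Fin n) → Universal X e →
               (m : ℕ) → CliquePartition X e m → OrientedDiamLE X 4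
mainTheorem6 n X e universal m partition =
  let c , opposite = oppositeColouring X e (cliquePartition⇒noIsolated partition)
  in HubOrientation.orientedDiam≤4 X e c universal opposite
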